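{- Let $G$ be the subgraph of $Q_5$ (with vertices written as binary strings $x_1x_2x_3x_4x_5$) whose edge set consists of the following $20$ edges: (1) all edges of $Q_5$ joining two vertices with $x_4=x_5=0$, except those joining two vertices with $x_2=x_4=x_5=0$; (2) the edges $\langle 01010,01110\rangle$ and $\langle 11010,11110\rangle$; (3) the edges $\langle 01101,11101\rangle$ and $\langle 01001,11001\rangle$; (4) the $4$ edges $\langle x, x\,\Delta\,\{4\}\rangle$ for the vertices $x$ with $x_2=1$, $x_4=x_5=0$; (5) the $4$ edges $\langle x, x\,\Delta\,\{5\}\rangle$ for the vertices $x$ with $x_2=1$, $x_4=x_5=0$. Then the path $P_4$ divides $G$.
   Context: $Q_5$ is the $5$-dimensional hypercube, with vertices identified with binary strings of length $5$, two vertices adjacent iff they differ in exactly one coordinate; $x\,\Delta\,\{i\}$ denotes the vertex obtained by flipping coordinate $i$. $P_4$ is the path with $4$ edges. If $H$ is isomorphic to a subgraph of $G'$, $H$ divides $G'$ if there exist embeddings $\theta_1,\ldots,\theta_r$ of $H$ into $G'$ such that $\{E(\theta_1(H)),\ldots,E(\theta_r(H))\}$ is a partition of $E(G')$. -}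

module Defs where

open import Data.Bool using (Bool; true; false; not; _xor_; if_then_else_)
open import Data.Nat using (ℕ; zero; suc)
open import Data.Fin using (Fin; zero; suc; inject₁)
open import Data.Vec using (Vec; []; _∷_; lookup; updateAt; zipWith; sum)
open import Data.Product using (Σ; _×_; _,_; ∃; ∃-syntax)
open import Data.Sum using (_⊎_)
open import Data.Empty using (⊥)
open import Relation.Binary.PropositionalEquality using (_≡_)
open import Function.Definitions using (Injective)

-- Vertices of Q_5: binary strings x₁x₂x₃x₄x₅, stored as Vec Bool 5
-- (false = 0, true = 1).  Coordinate i (1-based in the paper) is
-- position i-1 of the vector.
Vertex : Set
Vertex = Vec Bool 5

c1 c2 c3 c4 c5 : Fin 5
c1 = zero
c2 = suc zero
c3 = suc (suc zero)
c4 = suc (suc (suc zero))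
c5 = suc (suc (suc (suc zero)))

flip : Fin 5 → Vertex → Vertex
flip i x = updateAt x i not

hamming : Vertex → Vertex → ℕ
hamming x y = sum (zipWith (λ a b → if a xor b then 1 else 0) x y)

Q5Adj : Vertex → Vertex → Set
Q5Adj x y = hamming x y ≡ 1

SamePair : Vertex → Vertex → Vertex → Vertex → Set
SamePair x y u v = (x ≡ u × y ≡ v) ⊎ (x ≡ v × y ≡ u)

v01010 v01110 v11010 v11110 v01101 v11101 v01001 v11001 : Vertex
v01010 = false ∷ true ∷ false ∷ true ∷ false ∷ []
v01110 = false ∷ true ∷ true ∷ true ∷ false ∷ []
v11010 = true ∷ true ∷ false ∷ true ∷ false ∷ []
v11110 = true ∷ true ∷ true ∷ true ∷ false ∷ []
v01101 = false ∷ true ∷ true ∷ false ∷ true ∷ []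
v11101 = true ∷ true ∷ true ∷ false ∷ true ∷ []
v01001 = false ∷ true ∷ false ∷ false ∷ true ∷ []
v11001 = true ∷ true ∷ false ∷ false ∷ true ∷ []

Low45 : Vertex → Set
Low45 x = (lookup x c4 ≡ false) × (lookup x c5 ≡ false)

GEdge : Vertex → Vertex → Set
GEdge x y =
    (Q5Adj x y × Low45 x × Low45 y
       × ((lookup x c2 ≡ false × lookup y c2 ≡ false) → ⊥))
  ⊎ (SamePair x y v01010 v01110 ⊎ SamePair x y v11010 v11110)
  ⊎ (SamePair x y v01101 v11101 ⊎ SamePair x y v01001 v11001)
  ⊎ (∃[ z ] (lookup z c2 ≡ true × Low45 z × SamePair x y z (flip c4 z)))
  ⊎ (∃[ z ] (lookup z c2 ≡ true × Low45 z × SamePair x y z (flip c5 z)))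

-- P_4: vertices Fin 5, edges k ~ k+1 for k : Fin 4.
P4Edge₁ P4Edge₂ : Fin 4 → Fin 5
P4Edge₁ k = inject₁ k
P4Edge₂ k = suc k

record EmbeddingP4G : Set where
  field
    θ        : Fin 5 → Vertex
    injective : Injective _≡_ _≡_ θ
    preserves : ∀ (k : Fin 4) → GEdge (θ (P4Edge₁ k)) (θ (P4Edge₂ k))

open EmbeddingP4G public

-- P_4 divides G: there are embeddings θ₁..θ_r whose edge sets
-- partition E(G): every edge of G is the image of exactly one
-- (embedding, P_4-edge) pair.  (Images of embeddings lie in E(G) by
-- `preserves`.)
P4DividesG : Set
P4DividesG =
  Σ ℕ λ r → Σ (Fin r → EmbeddingP4G) λ Θ →
    ∀ (u v : Vertex) → GEdge u v →
      Σ (Fin r × Fin 4) λ { (j , k) →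
        SamePair (θ (Θ j) (P4Edge₁ k)) (θ (Θ j) (P4Edge₂ k)) u v
        × (∀ (j′ : Fin r) (k′ : Fin 4) →
             SamePair (θ (Θ j′) (P4Edge₁ k′)) (θ (Θ j′) (P4Edge₂ k′)) u v →
             (j′ ≡ j × k′ ≡ k)) }

module Submission where

-- Proof idea.  P₄ divides G once we exhibit five paths of length 4 in G
-- whose 20 edges are exactly the 20 edges of G, each occurring once:
--
--   11000 – 11001 – 01001 – 01000 – 00000
--   10000 – 11000 – 01000 – 01100 – 00100
--   01000 – 01010 – 01110 – 01100 – 11100
--   11000 – 11100 – 11101 – 01101 – 01100
--   11000 – 11010 – 11110 – 11100 – 10100

open import Defs
open import Data.Bool using (Bool; true; false)
open import Data.Bool.Properties using () renaming (_≟_ to _≟ᵇ_)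
open import Data.Nat using (ℕ; zero; suc; _/_; _%_; NonZero; _≡ᵇ_; _≟_)
open import Data.Fin using (Fin; zero; suc)
open import Data.Fin.Properties using (all?; any?) renaming (_≟_ to _≟ᶠ_)
open import Data.Vec using (Vec; []; _∷_; lookup)
open import Data.Vec.Properties using (≡-dec)
open import Data.Product using (Σ; ∃; ∃-syntax; _×_; _,_)
open import Data.Sum using (_⊎_; inj₁; inj₂; [_,_])
open import Relation.Nullary.Decidable
  using (Dec; yes; no; True; toWitness; map′; ¬?; _×-dec_; _⊎-dec_; _→-dec_)
open import Relation.Binary.PropositionalEquality using (_≡_; refl; sym)

_≟ᵛ_ : (x y : Vertex) → Dec (x ≡ y)
_≟ᵛ_ = ≡-dec _≟ᵇ_

samePair? : (x y u v : Vertex) → Dec (SamePair x y u v)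
samePair? x y u v = ((x ≟ᵛ u) ×-dec (y ≟ᵛ v)) ⊎-dec ((x ≟ᵛ v) ×-dec (y ≟ᵛ u))

low45? : (x : Vertex) → Dec (Low45 x)
low45? x = (lookup x c4 ≟ᵇ false) ×-dec (lookup x c5 ≟ᵇ false)

∃-two-candidates? : {A : Set} {P : A → Set} (x y : A) →
  (∀ z → P z → z ≡ x ⊎ z ≡ y) → Dec (P x) → Dec (P y) → Dec (∃ P)
∃-two-candidates? x y forced (yes px) _        = yes (x , px)
∃-two-candidates? x y forced (no ¬px) (yes py) = yes (y , py)
∃-two-candidates? x y forced (no ¬px) (no ¬py) = no λ { (z , pz) →
  [ (λ { refl → ¬px pz }) , (λ { refl → ¬py pz }) ] (forced z pz) }

FlipEdge : Fin 5 → Vertex → Vertex → Set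
FlipEdge i x y = ∃[ z ] (lookup z c2 ≡ true × Low45 z × SamePair x y z (flip i z))

-- The base vertex z of such an edge is one of its endpoints x, y.
flipEdge? : (i : Fin 5) (x y : Vertex) → Dec (FlipEdge i x y)
flipEdge? i x y = ∃-two-candidates? x y endpoint (based? x) (based? y)
  where
    based? : (z : Vertex) → Dec (lookup z c2 ≡ true × Low45 z × SamePair x y z (flip i z))
    based? z = (lookup z c2 ≟ᵇ true) ×-dec low45? z ×-dec samePair? x y z (flip i z)

    endpoint : ∀ z → lookup z c2 ≡ true × Low45 z × SamePair x y z (flip i z) → z ≡ x ⊎ z ≡ y
    endpoint z (_ , _ , inj₁ (x≡z , _)) = inj₁ (sym x≡z)
    endpoint z (_ , _ , inj₂ (_ , y≡z)) = inj₂ (sym y≡z)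

gEdge? : (x y : Vertex) → Dec (GEdge x y)
gEdge? x y =
     (hamming x y ≟ 1 ×-dec low45? x ×-dec low45? y
        ×-dec ¬? ((lookup x c2 ≟ᵇ false) ×-dec (lookup y c2 ≟ᵇ false)))
  ⊎-dec (samePair? x y v01010 v01110 ⊎-dec samePair? x y v11010 v11110)
  ⊎-dec (samePair? x y v01101 v11101 ⊎-dec samePair? x y v01001 v11001)
  ⊎-dec flipEdge? c4 x y
  ⊎-dec flipEdge? c5 x y

∀-Bool? : {P : Bool → Set} → ((b : Bool) → Dec (P b)) → Dec (∀ b → P b)
∀-Bool? P? = map′ (λ { (pf , pt) false → pf ; (pf , pt) true → pt })
                  (λ ∀P → ∀P false , ∀P true)
                  (P? false ×-dec P? true)

∀-cube? : {n : ℕ} {P : Vec Bool n → Set} → ((x : Vec Bool n) → Dec (P x)) → Dec (∀ x → P x)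
∀-cube? {zero}  P? = map′ (λ { p [] → p }) (λ ∀P → ∀P []) (P? [])
∀-cube? {suc n} P? = map′ (λ { ∀P (b ∷ x) → ∀P b x }) (λ ∀P b x → ∀P (b ∷ x))
                          (∀-Bool? λ b → ∀-cube? λ x → P? (b ∷ x))

module Decomposition {r : ℕ} (Θ : Fin r → EmbeddingP4G) where

  source target : Fin r → Fin 4 → Vertex
  source j k = θ (Θ j) (P4Edge₁ k)
  target j k = θ (Θ j) (P4Edge₂ k)

  Covered : Vertex → Vertex → Set
  Covered u v = Σ (Fin r × Fin 4) λ { (j , k) → SamePair (source j k) (target j k) u v }

  EdgesDistinct : Set
  EdgesDistinct = ∀ j k j′ k′ →
    SamePair (source j′ k′) (target j′ k′) (source j k) (target j k) → j′ ≡ j × k′ ≡ k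

  samePair-trans : {a b c d u v : Vertex} →
    SamePair a b u v → SamePair c d u v → SamePair a b c d
  samePair-trans (inj₁ (refl , refl)) (inj₁ (refl , refl)) = inj₁ (refl , refl)
  samePair-trans (inj₁ (refl , refl)) (inj₂ (refl , refl)) = inj₂ (refl , refl)
  samePair-trans (inj₂ (refl , refl)) (inj₁ (refl , refl)) = inj₂ (refl , refl)
  samePair-trans (inj₂ (refl , refl)) (inj₂ (refl , refl)) = inj₁ (refl , refl)

  decomposition : (∀ u v → GEdge u v → Covered u v) → EdgesDistinct → P4DividesG
  decomposition cover distinct = r , Θ , λ u v uv∈G →
    let ((j , k) , uv∈jk) = cover u v uv∈G
    in (j , k) , uv∈jk , λ j′ k′ uv∈j′k′ → distinct j k j′ k′ (samePair-trans uv∈j′k′ uv∈jk)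

  covered? : (u v : Vertex) → Dec (Covered u v)
  covered? u v = map′ (λ { (j , k , e) → (j , k) , e }) (λ { ((j , k) , e) → j , k , e })
    (any? λ j → any? λ k → samePair? (source j k) (target j k) u v)

  covers? : Dec (∀ u v → GEdge u v → Covered u v)
  covers? = ∀-cube? λ u → ∀-cube? λ v → gEdge? u v →-dec covered? u v

  edgesDistinct? : Dec EdgesDistinct
  edgesDistinct? = all? λ j → all? λ k → all? λ j′ → all? λ k′ →
    samePair? (source j′ k′) (target j′ k′) (source j k) (target j k)
      →-dec ((j′ ≟ᶠ j) ×-dec (k′ ≟ᶠ k))

Path : Set
Path = Vec Vertex 5

module _ (p : Path) where

  DistinctVertices : Set
  DistinctVertices = ∀ a b → lookup p a ≡ lookup p b → a ≡ b

  EdgesInG : Set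
  EdgesInG = ∀ k → GEdge (lookup p (P4Edge₁ k)) (lookup p (P4Edge₂ k))

  distinctVertices? : Dec DistinctVertices
  distinctVertices? = all? λ a → all? λ b → (lookup p a ≟ᵛ lookup p b) →-dec (a ≟ᶠ b)

  edgesInG? : Dec EdgesInG
  edgesInG? = all? λ k → gEdge? (lookup p (P4Edge₁ k)) (lookup p (P4Edge₂ k))

  -- A path with distinct vertices and all edges in G is an embedding of P₄;
  -- for a concrete path both conditions are checked by evaluation.
  pathEmbedding : {_ : True distinctVertices?} {_ : True edgesInG?} → EmbeddingP4G
  pathEmbedding {distinct} {inG} = record
    { θ         = lookup p
    ; injective = λ {a} {b} → toWitness distinct a b
    ; preserves = toWitness inG
    }

-- The vertex x₁x₂x₃x₄x₅ written as a decimal numeral, e.g. ⟨ 01101 ⟩.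
⟨_⟩ : ℕ → Vertex
⟨ n ⟩ = digit 10000 ∷ digit 1000 ∷ digit 100 ∷ digit 10 ∷ digit 1 ∷ []
  where
    digit : (place : ℕ) .{{_ : NonZero place}} → Bool
    digit place = (n / place) % 10 ≡ᵇ 1

paths : Fin 5 → EmbeddingP4G
paths zero                         = pathEmbedding (⟨ 11000 ⟩ ∷ ⟨ 11001 ⟩ ∷ ⟨ 01001 ⟩ ∷ ⟨ 01000 ⟩ ∷ ⟨ 00000 ⟩ ∷ [])
paths (suc zero)                   = pathEmbedding (⟨ 10000 ⟩ ∷ ⟨ 11000 ⟩ ∷ ⟨ 01000 ⟩ ∷ ⟨ 01100 ⟩ ∷ ⟨ 00100 ⟩ ∷ [])
paths (suc (suc zero))             = pathEmbedding (⟨ 01000 ⟩ ∷ ⟨ 01010 ⟩ ∷ ⟨ 01110 ⟩ ∷ ⟨ 01100 ⟩ ∷ ⟨ 11100 ⟩ ∷ [])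
paths (suc (suc (suc zero)))       = pathEmbedding (⟨ 11000 ⟩ ∷ ⟨ 11100 ⟩ ∷ ⟨ 11101 ⟩ ∷ ⟨ 01101 ⟩ ∷ ⟨ 01100 ⟩ ∷ [])
paths (suc (suc (suc (suc zero)))) = pathEmbedding (⟨ 11000 ⟩ ∷ ⟨ 11010 ⟩ ∷ ⟨ 11110 ⟩ ∷ ⟨ 11100 ⟩ ∷ ⟨ 10100 ⟩ ∷ [])

open Decomposition paths using (decomposition; covers?; edgesDistinct?)

lemma5 : P4DividesG
lemma5 = decomposition (toWitness {a? = covers?} _) (toWitness {a? = edgesDistinct?} _)
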